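{- For every $n\ge1$ and $w\in\mathfrak{S}_{2n}$, \[z(w)=n^2+\sum_{i=1}^n\bigl(h_i(p_A(w))-1\bigr)-ab(w)-bb(w).\]
   Context: A Dyck path of length $2N$ is a lattice path from $(0,0)$ to $(2N,0)$ with steps $(1,1)$ (up) and $(1,-1)$ (down) staying weakly above the $x$-axis; the down step ending at $x$-coordinate $k$ and going from height $h$ to $h-1$ is at position $k$ with height $h$; the path is determined by its set of down-step positions. $h_i(p)$ is the height of the $i$th down step of $p$. Crossout procedure: for $w\in\mathfrak{S}_{2n}$ in one-line notation, repeat until all positions are marked: mark "B" at the unmarked position $i$ with smallest value $w(i)$, then mark "A" at the leftmost unmarked position. $\mathcal{A}(w)$, $\mathcal{B}(w)$ are the sets of positions marked A and B. $p_A(w)$ is the Dyck path of length $2n$ with down-step positions $\{w(a):a\in\mathcal{A}(w)\}$. For $X,Y\in\{A,B\}$, an XY inversion of $w$ is a pair of positions $i<j$ with $w(i)>w(j)$, $i$ marked X and $j$ marked Y; $ab(w)$, $bb(w)$ are the numbers of AB and BB inversions. $z(w)=\#\{(i,j): i<j,\ w(i)<w(j),\ i\in\mathcal{B}(w)\}$. -}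

module Defs where

open import Data.Nat using (ℕ; zero; suc; _+_; _*_; _<ᵇ_; _≡ᵇ_)
open import Data.Bool using (Bool; true; false; if_then_else_; _∧_; not)
open import Data.List using (List; []; _∷_; length; map; foldr)
open import Data.Fin using (Fin; toℕ)
open import Data.Fin.Permutation using (Permutation′; _⟨$⟩ʳ_)
open import Data.Integer as ℤ using (ℤ; +_)
open import Data.Product using (_×_; _,_; proj₁; proj₂)
open import Relation.Nullary.Decidable using (⌊_⌋)
open import Data.List using (upTo; allFin)

-- Conventions: positions of a permutation w ∈ S_m are elements i of Fin m
-- (position toℕ i + 1 in the paper's 1-based numbering); the one-line
-- value of w at i is  val w i = toℕ (w ⟨$⟩ʳ i) + 1  ∈ {1,…,m}.

val : ∀ {m} → Permutation′ m → Fin m → ℕ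
val w i = suc (toℕ (w ⟨$⟩ʳ i))

elemᵇ : ℕ → List ℕ → Bool
elemᵇ x [] = false
elemᵇ x (y ∷ ys) = if x ≡ᵇ y then true else elemᵇ x ys

filterᵇ : ∀ {A : Set} → (A → Bool) → List A → List A
filterᵇ p [] = []
filterᵇ p (x ∷ xs) = if p x then x ∷ filterᵇ p xs else filterᵇ p xs

countᵇ : ∀ {A : Set} → (A → Bool) → List A → ℕ
countᵇ p [] = 0
countᵇ p (x ∷ xs) = if p x then suc (countᵇ p xs) else countᵇ p xs

-- Dyck paths of length 2N, given by their set of down-step positions
-- (a list of positions in {1,…,2N}).  The path is the one whose k-th step
-- (k = 1..2N) is a down step iff k ∈ D.

downSteps : (N : ℕ) → List ℕ → List ℕ
downSteps N D = filterᵇ (λ k → elemᵇ k D) (map suc (upTo (2 * N)))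

-- height of the path at x-coordinate k-1 (before step k) is
-- (k-1) - 2·#{d ∈ D : d < k}; a down step at position k goes from this
-- height h to h-1, and its height is h.
downHeight : List ℕ → ℕ → ℤ
downHeight D k = (+ (k Data.Nat.∸ 1)) ℤ.- (+ 2) ℤ.* (+ countᵇ (λ d → d <ᵇ k) D)
  where import Data.Nat

heights : (N : ℕ) → List ℕ → List ℤ
heights N D = map (downHeight D) (downSteps N D)

sumℤ : List ℤ → ℤ
sumℤ = foldr ℤ._+_ (+ 0)

argminRemove : ∀ {A : Set} → (A → ℕ) → A → List A → A × List A
argminRemove f a [] = a , []
argminRemove f a (x ∷ xs) with argminRemove f x xs
... | (b , rest) = if f b <ᵇ f a then (b , a ∷ rest) else (a , x ∷ rest)

-- removal preserving order of remaining positions: we keep the list of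
-- unmarked positions sorted increasingly, so "leftmost" = head.
removeFirst : ∀ {m} → Fin m → List (Fin m) → List (Fin m)
removeFirst i [] = []
removeFirst i (x ∷ xs) = if toℕ i ≡ᵇ toℕ x then xs else x ∷ removeFirst i xs

-- one round: mark B at the unmarked position with smallest value, then
-- mark A at the leftmost unmarked position.
-- Fuel = number of rounds; with 2n positions, exactly n rounds mark all.
crossoutAux : ∀ {m} → Permutation′ m → ℕ → List (Fin m) → List (Fin m) × List (Fin m)
crossoutAux w zero U = [] , []
crossoutAux w (suc r) [] = [] , []
crossoutAux w (suc r) (u ∷ us) with proj₁ (argminRemove (val w) u us)
... | b with removeFirst b (u ∷ us)
...   | [] = [] , (b ∷ [])   -- cannot occur for an even number of positions
...   | (a ∷ rest) with crossoutAux w r rest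
...     | (As , Bs) = (a ∷ As) , (b ∷ Bs)

crossout : ∀ n → Permutation′ (2 * n) → List (Fin (2 * n)) × List (Fin (2 * n))
crossout n w = crossoutAux w n (allFin (2 * n))

𝒜 : ∀ n → Permutation′ (2 * n) → List (Fin (2 * n))
𝒜 n w = proj₁ (crossout n w)

ℬ : ∀ n → Permutation′ (2 * n) → List (Fin (2 * n))
ℬ n w = proj₂ (crossout n w)

inA : ∀ n → Permutation′ (2 * n) → Fin (2 * n) → Bool
inA n w i = elemᵇ (toℕ i) (map toℕ (𝒜 n w))

inB : ∀ n → Permutation′ (2 * n) → Fin (2 * n) → Bool
inB n w i = elemᵇ (toℕ i) (map toℕ (ℬ n w))

pA-downs : ∀ n → Permutation′ (2 * n) → List ℕ
pA-downs n w = map (val w) (𝒜 n w)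

pairs : ∀ m → List (Fin m × Fin m)
pairs m = Data.List.concatMap (λ i → map (λ j → i , j)
            (filterᵇ (λ j → toℕ i <ᵇ toℕ j) (allFin m))) (allFin m)
  where import Data.List

ab : ∀ n → Permutation′ (2 * n) → ℕ
ab n w = countᵇ (λ p → (val w (proj₂ p) <ᵇ val w (proj₁ p))
                       ∧ inA n w (proj₁ p) ∧ inB n w (proj₂ p)) (pairs (2 * n))

bb : ∀ n → Permutation′ (2 * n) → ℕ
bb n w = countᵇ (λ p → (val w (proj₂ p) <ᵇ val w (proj₁ p))
                       ∧ inB n w (proj₁ p) ∧ inB n w (proj₂ p)) (pairs (2 * n))

z : ∀ n → Permutation′ (2 * n) → ℕ
z n w = countᵇ (λ p → (val w (proj₁ p) <ᵇ val w (proj₂ p))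
                      ∧ inB n w (proj₁ p)) (pairs (2 * n))

module Submission where

-- Write A = 𝒜(w), B = ℬ(w), and let m = 2n be the number of positions.
-- The proof combines three independent facts.
--  (1) The crossout procedure splits the positions into A and B, each of size n.  This is
--      the only property of the procedure that is used.
--  (2) The down step of p_A(w) at value w(a), a ∈ A, has height
--      (w(a) - 1) - 2·#{a′ ∈ A : w(a′) < w(a)}, hence
--        Σᵢ (hᵢ(p_A(w)) - 1) = Z - (2X + n),
--      with Z = #{(a, j) : a ∈ A, w(j) < w(a)} and X = #{(a, a′) ∈ A² : w(a′) < w(a)}.
--  (3) For ANY injective labelling f of m positions and ANY class A with complement B,
--        2 (z + ab + bb) + m + 4X = |A|² + |B|² + 2Z.
--      Every term is a sum over ordered pairs (i, j); after symmetrising (i, j) ↔ (j, i) both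
--      sides agree pair by pair, a finite check on the relative order of the positions, of
--      the labels, and on the classes of i and j.
-- With |A| = |B| = n, (3) reads z + ab + bb + (2X + n) = n² + Z, and (2) turns this into the
-- theorem.

open import Defs
open import Data.Nat using (ℕ; zero; suc; _+_; _*_; _∸_; _≤_; _<ᵇ_; _≡ᵇ_; _≟_; s≤s)
open import Data.Nat.Properties
  using ( +-*-semiring; +-commutativeSemigroup; +-assoc; +-suc; +-identityʳ; *-identityʳ
        ; *-distribʳ-+; *-cancelˡ-≡; suc-injective; ≡ᵇ⇒≡; <⇒≤; m+1+n≢0; n≤0⇒n≡0; ≤-pred
        ; m≤m+n; m≤n+m )
open import Data.Nat.Tactic.RingSolver using (solve-∀)
open import Data.Integer as ℤ using (+_)
open import Data.Integer.Properties using (pos-+; pos-*)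
import Data.Integer.Tactic.RingSolver as ℤ-Solver
open import Data.Bool using (Bool; true; false; not; _∧_; if_then_else_; T)
open import Data.List using (List; []; _∷_; map; length; concat; tabulate; applyUpTo; upTo; allFin; _++_)
open import Data.List.Properties using (map-∘; map-cong; length-tabulate)
open import Data.List.Membership.Propositional using (_∈_)
open import Data.List.Relation.Unary.Any using (here; there)
open import Data.Fin as Fin using (Fin; toℕ)
open import Data.Fin.Properties using (toℕ-injective; toℕ<n)
open import Data.Fin.Permutation using (Permutation′; _⟨$⟩ʳ_; _⟨$⟩ˡ_; inverseˡ)
open import Data.Product using (_×_; _,_; proj₁; proj₂)
open import Data.Empty using (⊥-elim)
open import Function using (_∘_; id)
open import Relation.Binary.PropositionalEquality
open import Relation.Nullary using (yes; no)
open import Algebra.Properties.CommutativeSemigroup +-commutativeSemigroup using (x∙yz≈y∙xz)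
open import Algebra.Properties.Semiring.Sum +-*-semiring
  using (sum; sum-cong-≗; ∑-distrib-+; ∑-comm; ∑-permute; *-distribˡ-sum; *-distribʳ-sum; sum-replicate-zero)

𝟙 : Bool → ℕ
𝟙 true  = 1
𝟙 false = 0

≡ᵇ-refl : ∀ a → (a ≡ᵇ a) ≡ true
≡ᵇ-refl zero    = refl
≡ᵇ-refl (suc a) = ≡ᵇ-refl a

≡ᵇ-sound : ∀ {a b} → (a ≡ᵇ b) ≡ true → a ≡ b
≡ᵇ-sound {a} {b} a≡ᵇb = ≡ᵇ⇒≡ a b (subst T (sym a≡ᵇb) _)

≡ᵇ-≢ : ∀ {a b} → a ≢ b → (a ≡ᵇ b) ≡ false
≡ᵇ-≢ {zero}  {zero}  a≢b = ⊥-elim (a≢b refl)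
≡ᵇ-≢ {zero}  {suc b} _   = refl
≡ᵇ-≢ {suc a} {zero}  _   = refl
≡ᵇ-≢ {suc a} {suc b} a≢b = ≡ᵇ-≢ (a≢b ∘ cong suc)

≡ᵇ-comm : ∀ a b → (a ≡ᵇ b) ≡ (b ≡ᵇ a)
≡ᵇ-comm zero    zero    = refl
≡ᵇ-comm zero    (suc b) = refl
≡ᵇ-comm (suc a) zero    = refl
≡ᵇ-comm (suc a) (suc b) = ≡ᵇ-comm a b

<ᵇ-irrefl : ∀ a → (a <ᵇ a) ≡ false
<ᵇ-irrefl zero    = refl
<ᵇ-irrefl (suc a) = <ᵇ-irrefl a

<ᵇ-flip : ∀ {a b} → a ≢ b → (b <ᵇ a) ≡ not (a <ᵇ b)
<ᵇ-flip {zero}  {zero}  a≢b = ⊥-elim (a≢b refl)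
<ᵇ-flip {zero}  {suc b} _   = refl
<ᵇ-flip {suc a} {zero}  _   = refl
<ᵇ-flip {suc a} {suc b} a≢b = <ᵇ-flip (a≢b ∘ cong suc)

∑-one : ∀ m → sum {m} (λ _ → 1) ≡ m
∑-one zero    = refl
∑-one (suc m) = cong suc (∑-one m)

∑-delta : ∀ {m} (a : Fin m) (f : Fin m → ℕ) → sum (λ j → 𝟙 (toℕ j ≡ᵇ toℕ a) * f j) ≡ f a
∑-delta {suc m} Fin.zero    f = trans (cong (λ s → f Fin.zero + 0 + s) (sum-replicate-zero m))
                                      (trans (+-identityʳ _) (+-identityʳ _))
∑-delta {suc m} (Fin.suc a) f = ∑-delta a (f ∘ Fin.suc)

∑-point : ∀ {m} (a : Fin m) → sum {m} (λ j → 𝟙 (toℕ a ≡ᵇ toℕ j)) ≡ 1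
∑-point {m} a = trans (sum-cong-≗ {m} swap) (∑-delta a (λ _ → 1))
  where
  swap : ∀ j → 𝟙 (toℕ a ≡ᵇ toℕ j) ≡ 𝟙 (toℕ j ≡ᵇ toℕ a) * 1
  swap j = trans (cong 𝟙 (≡ᵇ-comm (toℕ a) (toℕ j))) (sym (*-identityʳ _))

∑-below : ∀ {m} t → t ≤ m → sum {m} (λ k → 𝟙 (toℕ k <ᵇ t)) ≡ t
∑-below {m}     zero    _         = sum-replicate-zero m
∑-below {suc m} (suc t) (s≤s t≤m) = cong suc (∑-below t t≤m)

rank : ∀ {m} (π : Permutation′ m) (i : Fin m) →
       toℕ (π ⟨$⟩ʳ i) ≡ sum (λ j → 𝟙 (toℕ (π ⟨$⟩ʳ j) <ᵇ toℕ (π ⟨$⟩ʳ i)))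
rank π i = trans (sym (∑-below t (<⇒≤ (toℕ<n (π ⟨$⟩ʳ i))))) (∑-permute (λ k → 𝟙 (toℕ k <ᵇ t)) π)
  where t = toℕ (π ⟨$⟩ʳ i)

∑∑ : ∀ {m} → (Fin m → Fin m → ℕ) → ℕ
∑∑ F = sum (λ i → sum (F i))

module _ {m : ℕ} where

  ∑∑-cong : {F G : Fin m → Fin m → ℕ} → (∀ i j → F i j ≡ G i j) → ∑∑ F ≡ ∑∑ G
  ∑∑-cong F≗G = sum-cong-≗ (λ i → sum-cong-≗ (F≗G i))

  ∑∑-+ : (F G : Fin m → Fin m → ℕ) → ∑∑ (λ i j → F i j + G i j) ≡ ∑∑ F + ∑∑ G
  ∑∑-+ F G = trans (sum-cong-≗ (λ i → ∑-distrib-+ (F i) (G i)))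
                   (∑-distrib-+ (λ i → sum (F i)) (λ i → sum (G i)))

  ∑∑-scale : (k : ℕ) (F : Fin m → Fin m → ℕ) → ∑∑ (λ i j → k * F i j) ≡ k * ∑∑ F
  ∑∑-scale k F = trans (sum-cong-≗ (λ i → sym (*-distribˡ-sum k (F i))))
                       (sym (*-distribˡ-sum k (λ i → sum (F i))))

  ∑∑-factor : (g : Fin m → ℕ) (F : Fin m → Fin m → ℕ) →
              ∑∑ (λ i j → g i * F i j) ≡ sum (λ i → g i * sum (F i))
  ∑∑-factor g F = sum-cong-≗ (λ i → sym (*-distribˡ-sum (g i) (F i)))

  ∑∑-product : (g h : Fin m → ℕ) → ∑∑ (λ i j → g i * h j) ≡ sum g * sum h
  ∑∑-product g h = trans (∑∑-factor g (λ _ → h)) (sym (*-distribʳ-sum (sum h) g))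

  ∑∑-diagonal : ∑∑ {m} (λ i j → 𝟙 (toℕ i ≡ᵇ toℕ j)) ≡ m
  ∑∑-diagonal = trans (sum-cong-≗ {m} ∑-point) (∑-one m)

  ∑∑-symmetrize : {F G : Fin m → Fin m → ℕ} → (∀ i j → F i j + F j i ≡ G i j + G j i) → ∑∑ F ≡ ∑∑ G
  ∑∑-symmetrize {F} {G} balanced =
    *-cancelˡ-≡ (∑∑ F) (∑∑ G) 2 (trans (sym (doubled F)) (trans (∑∑-cong balanced) (doubled G)))
    where
    doubled : (H : Fin m → Fin m → ℕ) → ∑∑ (λ i j → H i j + H j i) ≡ 2 * ∑∑ H
    doubled H = begin
      ∑∑ (λ i j → H i j + H j i)  ≡⟨ ∑∑-+ H (λ i j → H j i) ⟩
      ∑∑ H + ∑∑ (λ i j → H j i)   ≡⟨ cong (λ s → ∑∑ H + s) (sym (∑-comm H)) ⟩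
      ∑∑ H + ∑∑ H                 ≡⟨ cong (λ s → ∑∑ H + s) (sym (+-identityʳ (∑∑ H))) ⟩
      2 * ∑∑ H                    ∎
      where open ≡-Reasoning

∑ₗ : {A : Set} → (A → ℕ) → List A → ℕ
∑ₗ f []       = 0
∑ₗ f (x ∷ xs) = f x + ∑ₗ f xs

module _ {A : Set} where

  countᵇ-∑ₗ : (p : A → Bool) (L : List A) → countᵇ p L ≡ ∑ₗ (𝟙 ∘ p) L
  countᵇ-∑ₗ p []       = refl
  countᵇ-∑ₗ p (x ∷ xs) with p x
  ... | true  = cong suc (countᵇ-∑ₗ p xs)
  ... | false = countᵇ-∑ₗ p xs

  length-∑ₗ : (L : List A) → length L ≡ ∑ₗ (λ _ → 1) L
  length-∑ₗ []       = refl
  length-∑ₗ (x ∷ xs) = cong suc (length-∑ₗ xs)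

  ∑ₗ-map : {B : Set} (f : B → ℕ) (g : A → B) (L : List A) → ∑ₗ f (map g L) ≡ ∑ₗ (f ∘ g) L
  ∑ₗ-map f g []       = refl
  ∑ₗ-map f g (x ∷ xs) = cong (λ s → f (g x) + s) (∑ₗ-map f g xs)

  ∑ₗ-filterᵇ : (f : A → ℕ) (p : A → Bool) (L : List A) →
               ∑ₗ f (filterᵇ p L) ≡ ∑ₗ (λ x → 𝟙 (p x) * f x) L
  ∑ₗ-filterᵇ f p []       = refl
  ∑ₗ-filterᵇ f p (x ∷ xs) with p x
  ... | true  = cong₂ _+_ (sym (+-identityʳ (f x))) (∑ₗ-filterᵇ f p xs)
  ... | false = ∑ₗ-filterᵇ f p xs

  ∑ₗ-++ : (f : A → ℕ) (L M : List A) → ∑ₗ f (L ++ M) ≡ ∑ₗ f L + ∑ₗ f M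
  ∑ₗ-++ f []       M = refl
  ∑ₗ-++ f (x ∷ xs) M = trans (cong (λ s → f x + s) (∑ₗ-++ f xs M)) (sym (+-assoc (f x) _ _))

  ∑ₗ-concat : (f : A → ℕ) (LL : List (List A)) → ∑ₗ f (concat LL) ≡ ∑ₗ (∑ₗ f) LL
  ∑ₗ-concat f []       = refl
  ∑ₗ-concat f (L ∷ LL) = trans (∑ₗ-++ f L (concat LL)) (cong (λ s → ∑ₗ f L + s) (∑ₗ-concat f LL))

  ∑ₗ-tabulate : ∀ {m} (f : A → ℕ) (g : Fin m → A) → ∑ₗ f (tabulate g) ≡ sum (f ∘ g)
  ∑ₗ-tabulate {zero}  f g = refl
  ∑ₗ-tabulate {suc m} f g = cong (λ s → f (g Fin.zero) + s) (∑ₗ-tabulate f (g ∘ Fin.suc))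

  ∑ₗ-applyUpTo : (f : A → ℕ) (g : ℕ → A) (m : ℕ) →
                 ∑ₗ f (applyUpTo g m) ≡ sum {m} (λ k → f (g (toℕ k)))
  ∑ₗ-applyUpTo f g zero    = refl
  ∑ₗ-applyUpTo f g (suc m) = cong (λ s → f (g 0) + s) (∑ₗ-applyUpTo f (g ∘ suc) m)

∑ₗ-pairs : ∀ m (F : Fin m × Fin m → ℕ) →
           ∑ₗ F (pairs m) ≡ ∑∑ (λ i j → 𝟙 (toℕ i <ᵇ toℕ j) * F (i , j))
∑ₗ-pairs m F = begin
  ∑ₗ F (concat (map row (allFin m)))  ≡⟨ ∑ₗ-concat F (map row (allFin m)) ⟩
  ∑ₗ (∑ₗ F) (map row (allFin m))      ≡⟨ ∑ₗ-map (∑ₗ F) row (allFin m) ⟩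
  ∑ₗ (∑ₗ F ∘ row) (allFin m)          ≡⟨ ∑ₗ-tabulate (∑ₗ F ∘ row) id ⟩
  sum (∑ₗ F ∘ row)                    ≡⟨ sum-cong-≗ row-sum ⟩
  ∑∑ (λ i j → 𝟙 (toℕ i <ᵇ toℕ j) * F (i , j)) ∎
  where
  open ≡-Reasoning
  later : Fin m → Fin m → Bool
  later i j = toℕ i <ᵇ toℕ j
  row : Fin m → List (Fin m × Fin m)
  row i = map (λ j → i , j) (filterᵇ (later i) (allFin m))
  row-sum : ∀ i → ∑ₗ F (row i) ≡ sum (λ j → 𝟙 (later i j) * F (i , j))
  row-sum i = trans (∑ₗ-map F (i ,_) (filterᵇ (later i) (allFin m)))
             (trans (∑ₗ-filterᵇ (λ j → F (i , j)) (later i) (allFin m))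
                    (∑ₗ-tabulate (λ j → 𝟙 (later i j) * F (i , j)) id))

count-pairs : ∀ m (P : Fin m × Fin m → Bool) →
              countᵇ P (pairs m) ≡ ∑∑ (λ i j → 𝟙 (toℕ i <ᵇ toℕ j) * 𝟙 (P (i , j)))
count-pairs m P = trans (countᵇ-∑ₗ P (pairs m)) (∑ₗ-pairs m (𝟙 ∘ P))

-- For an ordered pair (i, j) the weights below only see
-- u = [i < j], e = [i = j], l = [f i < f j], l′ = [f j < f i] and the classes x, y of i, j
-- (true = class A).  The left weight counts the pairs of z, ab, bb (twice), the diagonal,
-- and X (four times); the right weight counts A × A, B × B and Z (twice).

lhsWeight : (u e l l′ x y : Bool) → ℕ
lhsWeight u e l l′ x y =
  2 * (𝟙 u * 𝟙 (l ∧ not x) + 𝟙 u * 𝟙 (l′ ∧ x ∧ not y) + 𝟙 u * 𝟙 (l′ ∧ not x ∧ not y))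
  + 𝟙 e + 4 * (𝟙 x * (𝟙 y * 𝟙 l′))

rhsWeight : (l′ x y : Bool) → ℕ
rhsWeight l′ x y = 𝟙 x * 𝟙 y + 𝟙 (not x) * 𝟙 (not y) + 2 * (𝟙 x * 𝟙 l′)

data PairShape : (u u′ e e′ l l′ x y : Bool) → Set where
  distinct : ∀ u l x y → PairShape u (not u) false false l (not l) x y
  diagonal : ∀ x → PairShape false false true true false false x x

weights-balance : ∀ {u u′ e e′ l l′ x y} → PairShape u u′ e e′ l l′ x y →
                  lhsWeight u e l l′ x y + lhsWeight u′ e′ l′ l y x ≡ rhsWeight l′ x y + rhsWeight l y x
weights-balance (distinct false false false false) = refl
weights-balance (distinct false false false true)  = refl
weights-balance (distinct false false true  false) = refl
weights-balance (distinct false false true  true)  = refl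
weights-balance (distinct false true  false false) = refl
weights-balance (distinct false true  false true)  = refl
weights-balance (distinct false true  true  false) = refl
weights-balance (distinct false true  true  true)  = refl
weights-balance (distinct true  false false false) = refl
weights-balance (distinct true  false false true)  = refl
weights-balance (distinct true  false true  false) = refl
weights-balance (distinct true  false true  true)  = refl
weights-balance (distinct true  true  false false) = refl
weights-balance (distinct true  true  false true)  = refl
weights-balance (distinct true  true  true  false) = refl
weights-balance (distinct true  true  true  true)  = refl
weights-balance (diagonal false) = refl
weights-balance (diagonal true)  = refl

module PairCounting {m : ℕ} (f : Fin m → ℕ) (f-injective : ∀ {i j} → f i ≡ f j → i ≡ j)
                    (x : Fin m → Bool) where

  before : Fin m → Fin m → ℕ
  before i j = 𝟙 (toℕ i <ᵇ toℕ j)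

  below : Fin m → Fin m → ℕ
  below i j = 𝟙 (f j <ᵇ f i)

  Z X : ℕ
  Z = ∑∑ (λ i j → 𝟙 (x i) * below i j)
  X = ∑∑ (λ i j → 𝟙 (x i) * (𝟙 (x j) * below i j))

  nonInvB invAB invBB : ℕ
  nonInvB = ∑∑ (λ i j → before i j * 𝟙 ((f i <ᵇ f j) ∧ not (x i)))
  invAB   = ∑∑ (λ i j → before i j * 𝟙 ((f j <ᵇ f i) ∧ x i ∧ not (x j)))
  invBB   = ∑∑ (λ i j → before i j * 𝟙 ((f j <ᵇ f i) ∧ not (x i) ∧ not (x j)))

  sizeA sizeB : ℕ
  sizeA = sum (𝟙 ∘ x)
  sizeB = sum (𝟙 ∘ not ∘ x)

  private
    distinct′ : ∀ {u u′ e e′ l l′ x y} → u′ ≡ not u → e ≡ false → e′ ≡ false → l′ ≡ not l →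
                PairShape u u′ e e′ l l′ x y
    distinct′ refl refl refl refl = distinct _ _ _ _

    diagonal′ : ∀ {u e l x} → u ≡ false → e ≡ true → l ≡ false → PairShape u u e e l l x x
    diagonal′ refl refl refl = diagonal _

  -- Every pair has one of the two shapes; this is where injectivity of f enters.
  pair-shape : ∀ i j → PairShape (toℕ i <ᵇ toℕ j) (toℕ j <ᵇ toℕ i) (toℕ i ≡ᵇ toℕ j) (toℕ j ≡ᵇ toℕ i)
                                 (f i <ᵇ f j) (f j <ᵇ f i) (x i) (x j)
  pair-shape i j with toℕ i ≟ toℕ j
  ... | yes i≡j with toℕ-injective i≡j
  ...   | refl = diagonal′ (<ᵇ-irrefl (toℕ i)) (≡ᵇ-refl (toℕ i)) (<ᵇ-irrefl (f i))
  pair-shape i j | no i≢j =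
    distinct′ (<ᵇ-flip i≢j) (≡ᵇ-≢ i≢j) (≡ᵇ-≢ (i≢j ∘ sym)) (<ᵇ-flip (i≢j ∘ cong toℕ ∘ f-injective))

  lhs rhs : Fin m → Fin m → ℕ
  lhs i j = lhsWeight (toℕ i <ᵇ toℕ j) (toℕ i ≡ᵇ toℕ j) (f i <ᵇ f j) (f j <ᵇ f i) (x i) (x j)
  rhs i j = rhsWeight (f j <ᵇ f i) (x i) (x j)

  ∑∑-lhs : ∑∑ lhs ≡ 2 * (nonInvB + invAB + invBB) + m + 4 * X
  ∑∑-lhs = begin
    ∑∑ lhs
      ≡⟨ ∑∑-+ (λ i j → 2 * counted i j + diagonalPair i j) (λ i j → 4 * pairA i j) ⟩
    ∑∑ (λ i j → 2 * counted i j + diagonalPair i j) + ∑∑ (λ i j → 4 * pairA i j)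
      ≡⟨ cong₂ _+_ (∑∑-+ (λ i j → 2 * counted i j) diagonalPair) (∑∑-scale 4 pairA) ⟩
    ∑∑ (λ i j → 2 * counted i j) + ∑∑ diagonalPair + 4 * X
      ≡⟨ cong₂ (λ s d → s + d + 4 * X) (trans (∑∑-scale 2 counted) (cong (2 *_) ∑∑-counted))
                                        (∑∑-diagonal {m}) ⟩
    2 * (nonInvB + invAB + invBB) + m + 4 * X ∎
    where
    open ≡-Reasoning
    nonInversionB inversionAB inversionBB counted pairA diagonalPair : Fin m → Fin m → ℕ
    nonInversionB i j = before i j * 𝟙 ((f i <ᵇ f j) ∧ not (x i))
    inversionAB i j   = before i j * 𝟙 ((f j <ᵇ f i) ∧ x i ∧ not (x j))
    inversionBB i j   = before i j * 𝟙 ((f j <ᵇ f i) ∧ not (x i) ∧ not (x j))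
    counted i j       = nonInversionB i j + inversionAB i j + inversionBB i j
    pairA i j         = 𝟙 (x i) * (𝟙 (x j) * below i j)
    diagonalPair i j  = 𝟙 (toℕ i ≡ᵇ toℕ j)
    ∑∑-counted : ∑∑ counted ≡ nonInvB + invAB + invBB
    ∑∑-counted = trans (∑∑-+ (λ i j → nonInversionB i j + inversionAB i j) inversionBB)
                       (cong (_+ invBB) (∑∑-+ nonInversionB inversionAB))

  ∑∑-rhs : ∑∑ rhs ≡ sizeA * sizeA + sizeB * sizeB + 2 * Z
  ∑∑-rhs = begin
    ∑∑ rhs
      ≡⟨ ∑∑-+ (λ i j → bothA i j + bothB i j) (λ i j → 2 * (𝟙 (x i) * below i j)) ⟩
    ∑∑ (λ i j → bothA i j + bothB i j) + ∑∑ (λ i j → 2 * (𝟙 (x i) * below i j))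
      ≡⟨ cong₂ _+_ (∑∑-+ bothA bothB) (∑∑-scale 2 (λ i j → 𝟙 (x i) * below i j)) ⟩
    ∑∑ bothA + ∑∑ bothB + 2 * Z
      ≡⟨ cong₂ (λ a b → a + b + 2 * Z) (∑∑-product (𝟙 ∘ x) (𝟙 ∘ x))
                                        (∑∑-product (𝟙 ∘ not ∘ x) (𝟙 ∘ not ∘ x)) ⟩
    sizeA * sizeA + sizeB * sizeB + 2 * Z ∎
    where
    open ≡-Reasoning
    bothA bothB : Fin m → Fin m → ℕ
    bothA i j = 𝟙 (x i) * 𝟙 (x j)
    bothB i j = 𝟙 (not (x i)) * 𝟙 (not (x j))

  pair-identity : 2 * (nonInvB + invAB + invBB) + m + 4 * X ≡ sizeA * sizeA + sizeB * sizeB + 2 * Z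
  pair-identity = begin
    2 * (nonInvB + invAB + invBB) + m + 4 * X ≡⟨ ∑∑-lhs ⟨
    ∑∑ lhs                                     ≡⟨ ∑∑-symmetrize (λ i j → weights-balance (pair-shape i j)) ⟩
    ∑∑ rhs                                     ≡⟨ ∑∑-rhs ⟩
    sizeA * sizeA + sizeB * sizeB + 2 * Z      ∎
    where open ≡-Reasoning

-- Fact (1): the crossout procedure.  It only ever moves positions from the list of unmarked
-- positions into the A-list or the B-list.

argminRemove-∈ : ∀ {A : Set} (f : A → ℕ) a xs → proj₁ (argminRemove f a xs) ∈ a ∷ xs
argminRemove-∈ f a []       = here refl
argminRemove-∈ f a (x ∷ xs) with argminRemove f x xs | argminRemove-∈ f x xs
... | (b , _) | b∈ with f b <ᵇ f a
...   | true  = there b∈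
...   | false = here refl

removeFirst-∑ₗ : ∀ {m} (f : Fin m → ℕ) {b} (L : List (Fin m)) → b ∈ L →
                 f b + ∑ₗ f (removeFirst b L) ≡ ∑ₗ f L
removeFirst-∑ₗ f {b} (x ∷ xs) b∈ with toℕ b ≡ᵇ toℕ x in b≡ᵇx
... | true = cong (λ y → f y + ∑ₗ f xs) (toℕ-injective (≡ᵇ-sound b≡ᵇx))
removeFirst-∑ₗ f {b} (x ∷ xs) (here refl) | false with trans (sym (≡ᵇ-refl (toℕ b))) b≡ᵇx
... | ()
removeFirst-∑ₗ f {b} (x ∷ xs) (there b∈xs) | false =
  trans (x∙yz≈y∙xz (f b) (f x) (∑ₗ f (removeFirst b xs)))
        (cong (λ s → f x + s) (removeFirst-∑ₗ f xs b∈xs))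

removeFirst-length : ∀ {m} {b : Fin m} (L : List (Fin m)) → b ∈ L →
                     suc (length (removeFirst b L)) ≡ length L
removeFirst-length {b = b} L b∈L = begin
  suc (length (removeFirst b L))      ≡⟨ cong suc (length-∑ₗ (removeFirst b L)) ⟩
  1 + ∑ₗ (λ _ → 1) (removeFirst b L) ≡⟨ removeFirst-∑ₗ (λ _ → 1) L b∈L ⟩
  ∑ₗ (λ _ → 1) L                      ≡⟨ length-∑ₗ L ⟨
  length L                            ∎
  where open ≡-Reasoning

record Splits {m} (r : ℕ) (U : List (Fin m)) (AB : List (Fin m) × List (Fin m)) : Set where
  field
    total   : ∀ f → ∑ₗ f (proj₁ AB) + ∑ₗ f (proj₂ AB) ≡ ∑ₗ f U
    length₁ : length (proj₁ AB) ≡ r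
    length₂ : length (proj₂ AB) ≡ r

private
  halve : ∀ {k} r → suc (suc k) ≡ 2 * suc r → k ≡ 2 * r
  halve r e = suc-injective (suc-injective (trans e (cong suc (+-suc r (r + 0)))))

  regroup-split : ∀ x X y Y → (x + X) + (y + Y) ≡ y + (x + (X + Y))
  regroup-split = solve-∀

crossoutAux-splits : ∀ {m} (w : Permutation′ m) r (U : List (Fin m)) → length U ≡ 2 * r →
                     Splits r U (crossoutAux w r U)
crossoutAux-splits w zero    []       _   = record { total = λ _ → refl ; length₁ = refl ; length₂ = refl }
crossoutAux-splits w (suc r) (u ∷ us) len
  with proj₁ (argminRemove (val w) u us) | argminRemove-∈ (val w) u us
... | b | b∈U
  with removeFirst b (u ∷ us) | (λ f → removeFirst-∑ₗ f (u ∷ us) b∈U) | removeFirst-length (u ∷ us) b∈U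
...   | []       | _       | len′ = ⊥-elim (m+1+n≢0 r (sym (suc-injective (trans len′ len))))
...   | a ∷ rest | removed | len′
  with crossoutAux w r rest | crossoutAux-splits w r rest (halve r (trans len′ len))
...     | (As , Bs) | record { total = total ; length₁ = length₁ ; length₂ = length₂ } = record
  { total   = λ f → trans (regroup-split (f a) (∑ₗ f As) (f b) (∑ₗ f Bs))
                          (trans (cong (λ s → f b + (f a + s)) (total f)) (removed f))
  ; length₁ = cong suc length₁
  ; length₂ = cong suc length₂
  }

mult : ∀ {m} → List (Fin m) → Fin m → ℕ
mult L i = ∑ₗ (λ a → 𝟙 (toℕ i ≡ᵇ toℕ a)) L

member : ∀ {m} → Fin m → List (Fin m) → Bool
member i L = elemᵇ (toℕ i) (map toℕ L)

∑ₗ-mult : ∀ {m} (f : Fin m → ℕ) (L : List (Fin m)) → ∑ₗ f L ≡ sum (λ j → mult L j * f j)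
∑ₗ-mult {m} f []      = sym (sum-replicate-zero m)
∑ₗ-mult {m} f (a ∷ L) = sym (begin
  sum (λ j → (𝟙 (toℕ j ≡ᵇ toℕ a) + mult L j) * f j)
    ≡⟨ sum-cong-≗ (λ j → *-distribʳ-+ (f j) (𝟙 (toℕ j ≡ᵇ toℕ a)) (mult L j)) ⟩
  sum (λ j → 𝟙 (toℕ j ≡ᵇ toℕ a) * f j + mult L j * f j)
    ≡⟨ ∑-distrib-+ (λ j → 𝟙 (toℕ j ≡ᵇ toℕ a) * f j) (λ j → mult L j * f j) ⟩
  sum (λ j → 𝟙 (toℕ j ≡ᵇ toℕ a) * f j) + sum (λ j → mult L j * f j)
    ≡⟨ cong₂ _+_ (∑-delta a f) (sym (∑ₗ-mult f L)) ⟩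
  f a + ∑ₗ f L ∎)
  where open ≡-Reasoning

member-mult : ∀ {m} (i : Fin m) (L : List (Fin m)) → mult L i ≤ 1 → 𝟙 (member i L) ≡ mult L i
member-mult i []      _ = refl
member-mult i (a ∷ L) h with toℕ i ≡ᵇ toℕ a
... | true  = cong suc (sym (n≤0⇒n≡0 (≤-pred h)))
... | false = member-mult i L h

∑ₗ-member : ∀ {m} (L : List (Fin m)) → (∀ i → mult L i ≤ 1) →
            ∀ f → ∑ₗ f L ≡ sum (λ j → 𝟙 (member j L) * f j)
∑ₗ-member L simple f =
  trans (∑ₗ-mult f L) (sum-cong-≗ (λ j → cong (_* f j) (sym (member-mult j L (simple j)))))

size-member : ∀ {m} (L : List (Fin m)) → (∀ i → mult L i ≤ 1) → sum (λ j → 𝟙 (member j L)) ≡ length L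
size-member L simple = begin
  sum (λ j → 𝟙 (member j L))      ≡⟨ sum-cong-≗ (λ j → *-identityʳ (𝟙 (member j L))) ⟨
  sum (λ j → 𝟙 (member j L) * 1)  ≡⟨ ∑ₗ-member L simple (λ _ → 1) ⟨
  ∑ₗ (λ _ → 1) L                  ≡⟨ length-∑ₗ L ⟨
  length L                        ∎
  where open ≡-Reasoning

𝟙-complement : ∀ x y → 𝟙 x + 𝟙 y ≡ 1 → y ≡ not x
𝟙-complement true  false _ = refl
𝟙-complement false true  _ = refl

module Crossout (n : ℕ) (w : Permutation′ (2 * n)) where

  open Splits (crossoutAux-splits w n (allFin (2 * n)) (length-tabulate id))

  mult-𝒜-ℬ : ∀ i → mult (𝒜 n w) i + mult (ℬ n w) i ≡ 1
  mult-𝒜-ℬ i = trans (total (λ a → 𝟙 (toℕ i ≡ᵇ toℕ a)))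
                     (trans (∑ₗ-tabulate {m = 2 * n} (λ a → 𝟙 (toℕ i ≡ᵇ toℕ a)) id) (∑-point i))

  𝒜-simple : ∀ i → mult (𝒜 n w) i ≤ 1
  𝒜-simple i = subst (mult (𝒜 n w) i ≤_) (mult-𝒜-ℬ i) (m≤m+n _ _)

  ℬ-simple : ∀ i → mult (ℬ n w) i ≤ 1
  ℬ-simple i = subst (mult (ℬ n w) i ≤_) (mult-𝒜-ℬ i) (m≤n+m _ _)

  inB-not-inA : ∀ i → inB n w i ≡ not (inA n w i)
  inB-not-inA i = 𝟙-complement (inA n w i) (inB n w i)
    (trans (cong₂ _+_ (member-mult i (𝒜 n w) (𝒜-simple i)) (member-mult i (ℬ n w) (ℬ-simple i)))
           (mult-𝒜-ℬ i))

  ∑ₗ-𝒜 : ∀ f → ∑ₗ f (𝒜 n w) ≡ sum (λ j → 𝟙 (inA n w j) * f j)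
  ∑ₗ-𝒜 = ∑ₗ-member (𝒜 n w) 𝒜-simple

  size-𝒜 : sum (λ i → 𝟙 (inA n w i)) ≡ n
  size-𝒜 = trans (size-member (𝒜 n w) 𝒜-simple) length₁

  size-ℬ : sum (λ i → 𝟙 (not (inA n w i))) ≡ n
  size-ℬ = trans (sum-cong-≗ (λ i → cong 𝟙 (sym (inB-not-inA i))))
                 (trans (size-member (ℬ n w) ℬ-simple) length₂)

val-injective : ∀ {m} (w : Permutation′ m) {i j} → val w i ≡ val w j → i ≡ j
val-injective w {i} {j} eq = begin
  i                   ≡⟨ inverseˡ w ⟨
  w ⟨$⟩ˡ (w ⟨$⟩ʳ i)  ≡⟨ cong (w ⟨$⟩ˡ_) (toℕ-injective (suc-injective eq)) ⟩
  w ⟨$⟩ˡ (w ⟨$⟩ʳ j)  ≡⟨ inverseˡ w ⟩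
  j                   ∎
  where open ≡-Reasoning

≡ᵇ-injective : ∀ {m} (g : Fin m → ℕ) → (∀ {i j} → g i ≡ g j → i ≡ j) →
               ∀ i j → (g i ≡ᵇ g j) ≡ (toℕ i ≡ᵇ toℕ j)
≡ᵇ-injective g g-injective i j with toℕ i ≟ toℕ j
... | yes i≡j with toℕ-injective i≡j
...   | refl = trans (≡ᵇ-refl (g i)) (sym (≡ᵇ-refl (toℕ i)))
≡ᵇ-injective g g-injective i j | no i≢j =
  trans (≡ᵇ-≢ (i≢j ∘ cong toℕ ∘ g-injective)) (sym (≡ᵇ-≢ i≢j))

elemᵇ-injective : ∀ {m} (g : Fin m → ℕ) → (∀ {i j} → g i ≡ g j → i ≡ j) →
                  ∀ i (L : List (Fin m)) → elemᵇ (g i) (map g L) ≡ member i L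
elemᵇ-injective g g-injective i []      = refl
elemᵇ-injective g g-injective i (a ∷ L) =
  cong₂ (λ hit rest → if hit then true else rest)
        (≡ᵇ-injective g g-injective i a) (elemᵇ-injective g g-injective i L)

-- Heights of a Dyck path given by its set D of down steps: a down step at k has height
-- h = (k-1) - 2·#{d ∈ D : d < k}, so h - 1 is a difference of two natural numbers.
height-minus-one : ∀ D k → downHeight D k ℤ.- + 1 ≡ + (k ∸ 1) ℤ.- + (2 * countᵇ (λ d → d <ᵇ k) D + 1)
height-minus-one D k = begin
  + (k ∸ 1) ℤ.- + 2 ℤ.* + c ℤ.- + 1      ≡⟨ rearrange (+ (k ∸ 1)) (+ c) ⟩
  + (k ∸ 1) ℤ.- (+ 2 ℤ.* + c ℤ.+ + 1)    ≡⟨ cong (λ t → + (k ∸ 1) ℤ.- (t ℤ.+ + 1)) (pos-* 2 c) ⟨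
  + (k ∸ 1) ℤ.- (+ (2 * c) ℤ.+ + 1)      ≡⟨ cong (λ t → + (k ∸ 1) ℤ.- t) (pos-+ (2 * c) 1) ⟨
  + (k ∸ 1) ℤ.- + (2 * c + 1)            ∎
  where
  open ≡-Reasoning
  c = countᵇ (λ d → d <ᵇ k) D
  rearrange : ∀ a c → a ℤ.- + 2 ℤ.* c ℤ.- + 1 ≡ a ℤ.- (+ 2 ℤ.* c ℤ.+ + 1)
  rearrange = ℤ-Solver.solve-∀

sumℤ-difference : ∀ {A : Set} (a b : A → ℕ) (L : List A) →
                  sumℤ (map (λ k → + a k ℤ.- + b k) L) ≡ + ∑ₗ a L ℤ.- + ∑ₗ b L
sumℤ-difference a b []      = refl
sumℤ-difference a b (k ∷ L) = begin
  (+ a k ℤ.- + b k) ℤ.+ sumℤ (map (λ k → + a k ℤ.- + b k) L)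
    ≡⟨ cong (λ s → (+ a k ℤ.- + b k) ℤ.+ s) (sumℤ-difference a b L) ⟩
  (+ a k ℤ.- + b k) ℤ.+ (+ ∑ₗ a L ℤ.- + ∑ₗ b L)
    ≡⟨ regroup (+ a k) (+ b k) (+ ∑ₗ a L) (+ ∑ₗ b L) ⟩
  (+ a k ℤ.+ + ∑ₗ a L) ℤ.- (+ b k ℤ.+ + ∑ₗ b L)
    ≡⟨ cong₂ ℤ._-_ (pos-+ (a k) (∑ₗ a L)) (pos-+ (b k) (∑ₗ b L)) ⟨
  + (a k + ∑ₗ a L) ℤ.- + (b k + ∑ₗ b L) ∎
  where
  open ≡-Reasoning
  regroup : ∀ x y X Y → (x ℤ.- y) ℤ.+ (X ℤ.- Y) ≡ (x ℤ.+ X) ℤ.- (y ℤ.+ Y)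
  regroup = ℤ-Solver.solve-∀

heights-sum : ∀ D (p : ℕ → Bool) (L : List ℕ) →
  sumℤ (map (λ h → h ℤ.- + 1) (map (downHeight D) (filterᵇ p L)))
  ≡ + ∑ₗ (λ k → 𝟙 (p k) * (k ∸ 1)) L ℤ.- + ∑ₗ (λ k → 𝟙 (p k) * (2 * countᵇ (λ d → d <ᵇ k) D + 1)) L
heights-sum D p L = begin
  sumℤ (map (λ h → h ℤ.- + 1) (map (downHeight D) F))
    ≡⟨ cong sumℤ (map-∘ F) ⟨
  sumℤ (map (λ k → downHeight D k ℤ.- + 1) F)
    ≡⟨ cong sumℤ (map-cong (height-minus-one D) F) ⟩
  sumℤ (map (λ k → + (k ∸ 1) ℤ.- + left k) F)
    ≡⟨ sumℤ-difference (_∸ 1) left F ⟩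
  + ∑ₗ (_∸ 1) F ℤ.- + ∑ₗ left F
    ≡⟨ cong₂ (λ a b → + a ℤ.- + b) (∑ₗ-filterᵇ (_∸ 1) p L) (∑ₗ-filterᵇ left p L) ⟩
  + ∑ₗ (λ k → 𝟙 (p k) * (k ∸ 1)) L ℤ.- + ∑ₗ (λ k → 𝟙 (p k) * left k) L ∎
  where
  open ≡-Reasoning
  F = filterᵇ p L
  left : ℕ → ℕ
  left k = 2 * countᵇ (λ d → d <ᵇ k) D + 1

module CrossoutCounts (n : ℕ) (w : Permutation′ (2 * n)) where

  open Crossout n w
  open PairCounting (val w) (val-injective w) (inA n w)

  z-pairs : z n w ≡ nonInvB
  z-pairs = trans (count-pairs (2 * n) _)
    (∑∑-cong (λ i j → cong (λ b → before i j * 𝟙 ((val w i <ᵇ val w j) ∧ b)) (inB-not-inA i)))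

  ab-pairs : ab n w ≡ invAB
  ab-pairs = trans (count-pairs (2 * n) _)
    (∑∑-cong (λ i j → cong (λ b → before i j * 𝟙 ((val w j <ᵇ val w i) ∧ inA n w i ∧ b)) (inB-not-inA j)))

  bb-pairs : bb n w ≡ invBB
  bb-pairs = trans (count-pairs (2 * n) _)
    (∑∑-cong (λ i j → cong₂ (λ b b′ → before i j * 𝟙 ((val w j <ᵇ val w i) ∧ b ∧ b′))
                            (inB-not-inA i) (inB-not-inA j)))

  counting : z n w + ab n w + bb n w + (2 * X + n) ≡ n * n + Z
  counting = *-cancelˡ-≡ _ _ 2 (begin
    2 * (z n w + ab n w + bb n w + (2 * X + n))
      ≡⟨ expand (z n w + ab n w + bb n w) X n ⟩
    2 * (z n w + ab n w + bb n w) + 2 * n + 4 * X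
      ≡⟨ cong (λ s → 2 * s + 2 * n + 4 * X) (cong₂ _+_ (cong₂ _+_ z-pairs ab-pairs) bb-pairs) ⟩
    2 * (nonInvB + invAB + invBB) + 2 * n + 4 * X
      ≡⟨ pair-identity ⟩
    sizeA * sizeA + sizeB * sizeB + 2 * Z
      ≡⟨ cong₂ (λ a b → a * a + b * b + 2 * Z) size-𝒜 size-ℬ ⟩
    n * n + n * n + 2 * Z
      ≡⟨ double (n * n) Z ⟨
    2 * (n * n + Z) ∎)
    where
    open ≡-Reasoning
    expand : ∀ s X n → 2 * (s + (2 * X + n)) ≡ 2 * s + 2 * n + 4 * X
    expand = solve-∀
    double : ∀ a b → 2 * (a + b) ≡ a + a + 2 * b
    double = solve-∀

  ∑ₗ-values : (g : ℕ → ℕ) → ∑ₗ g (map suc (upTo (2 * n))) ≡ sum (λ i → g (val w i))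
  ∑ₗ-values g = begin
    ∑ₗ g (map suc (upTo (2 * n)))          ≡⟨ ∑ₗ-map g suc (upTo (2 * n)) ⟩
    ∑ₗ (g ∘ suc) (upTo (2 * n))            ≡⟨ ∑ₗ-applyUpTo (g ∘ suc) id (2 * n) ⟩
    sum {2 * n} (λ k → g (suc (toℕ k)))    ≡⟨ ∑-permute (λ k → g (suc (toℕ k))) w ⟩
    sum (λ i → g (val w i))                ∎
    where open ≡-Reasoning

  is-down-step : ∀ i → 𝟙 (elemᵇ (val w i) (pA-downs n w)) ≡ 𝟙 (inA n w i)
  is-down-step i = cong 𝟙 (elemᵇ-injective (val w) (val-injective w) i (𝒜 n w))

  down-steps-before : ∀ i → countᵇ (λ d → d <ᵇ val w i) (pA-downs n w)
                            ≡ sum (λ j → 𝟙 (inA n w j) * below i j)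
  down-steps-before i = begin
    countᵇ (_<ᵇ val w i) (map (val w) (𝒜 n w))     ≡⟨ countᵇ-∑ₗ (_<ᵇ val w i) (map (val w) (𝒜 n w)) ⟩
    ∑ₗ (𝟙 ∘ (_<ᵇ val w i)) (map (val w) (𝒜 n w))  ≡⟨ ∑ₗ-map (𝟙 ∘ (_<ᵇ val w i)) (val w) (𝒜 n w) ⟩
    ∑ₗ (below i) (𝒜 n w)                          ≡⟨ ∑ₗ-𝒜 (below i) ⟩
    sum (λ j → 𝟙 (inA n w j) * below i j)          ∎
    where open ≡-Reasoning

  heights-pA : sumℤ (map (λ h → h ℤ.- + 1) (heights n (pA-downs n w))) ≡ + Z ℤ.- + (2 * X + n)
  heights-pA = trans (heights-sum D (λ k → elemᵇ k D) (map suc (upTo (2 * n))))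
                     (cong₂ (λ a b → + a ℤ.- + b) ranks-of-A descents-of-A)
    where
    open ≡-Reasoning
    D = pA-downs n w
    χ : Fin (2 * n) → ℕ
    χ i = 𝟙 (inA n w i)
    ranks-of-A : ∑ₗ (λ k → 𝟙 (elemᵇ k D) * (k ∸ 1)) (map suc (upTo (2 * n))) ≡ Z
    ranks-of-A = begin
      ∑ₗ (λ k → 𝟙 (elemᵇ k D) * (k ∸ 1)) (map suc (upTo (2 * n)))
        ≡⟨ ∑ₗ-values (λ k → 𝟙 (elemᵇ k D) * (k ∸ 1)) ⟩
      sum (λ i → 𝟙 (elemᵇ (val w i) D) * toℕ (w ⟨$⟩ʳ i))
        ≡⟨ sum-cong-≗ (λ i → cong₂ _*_ (is-down-step i) (rank w i)) ⟩
      sum (λ i → χ i * sum (below i))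
        ≡⟨ ∑∑-factor χ below ⟨
      Z ∎
    descents-of-A : ∑ₗ (λ k → 𝟙 (elemᵇ k D) * (2 * countᵇ (λ d → d <ᵇ k) D + 1)) (map suc (upTo (2 * n)))
                    ≡ 2 * X + n
    descents-of-A = begin
      ∑ₗ (λ k → 𝟙 (elemᵇ k D) * (2 * countᵇ (λ d → d <ᵇ k) D + 1)) (map suc (upTo (2 * n)))
        ≡⟨ ∑ₗ-values (λ k → 𝟙 (elemᵇ k D) * (2 * countᵇ (λ d → d <ᵇ k) D + 1)) ⟩
      sum (λ i → 𝟙 (elemᵇ (val w i) D) * (2 * countᵇ (λ d → d <ᵇ val w i) D + 1))
        ≡⟨ sum-cong-≗ (λ i → cong₂ (λ a c → a * (2 * c + 1)) (is-down-step i) (down-steps-before i)) ⟩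
      sum (λ i → χ i * (2 * C i + 1))
        ≡⟨ sum-cong-≗ (λ i → spread (χ i) (C i)) ⟩
      sum (λ i → 2 * (χ i * C i) + χ i)
        ≡⟨ ∑-distrib-+ (λ i → 2 * (χ i * C i)) χ ⟩
      sum (λ i → 2 * (χ i * C i)) + sum χ
        ≡⟨ cong₂ _+_ (sym (*-distribˡ-sum 2 (λ i → χ i * C i))) size-𝒜 ⟩
      2 * sum (λ i → χ i * C i) + n
        ≡⟨ cong (λ s → 2 * s + n) (∑∑-factor χ (λ i j → χ j * below i j)) ⟨
      2 * X + n ∎
      where
      C : Fin (2 * n) → ℕ
      C i = sum (λ j → χ j * below i j)
      spread : ∀ a c → a * (2 * c + 1) ≡ 2 * (a * c) + a
      spread = solve-∀

isolate : ∀ {z a b k N Z} → z + a + b + k ≡ N + Z → + z ≡ + N ℤ.+ (+ Z ℤ.- + k) ℤ.- + a ℤ.- + b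
isolate {z} {a} {b} {k} {N} {Z} total = begin
  + z                                                   ≡⟨ take-apart (+ z) (+ a) (+ b) (+ k) ⟩
  + z ℤ.+ + a ℤ.+ + b ℤ.+ + k ℤ.- + a ℤ.- + b ℤ.- + k  ≡⟨ cong (λ s → s ℤ.- + a ℤ.- + b ℤ.- + k) embedded ⟩
  + N ℤ.+ + Z ℤ.- + a ℤ.- + b ℤ.- + k                  ≡⟨ regroup (+ N) (+ Z) (+ a) (+ b) (+ k) ⟩
  + N ℤ.+ (+ Z ℤ.- + k) ℤ.- + a ℤ.- + b               ∎
  where
  open ≡-Reasoning
  embedded : + z ℤ.+ + a ℤ.+ + b ℤ.+ + k ≡ + N ℤ.+ + Z
  embedded = begin
    + z ℤ.+ + a ℤ.+ + b ℤ.+ + k  ≡⟨ cong (λ s → s ℤ.+ + b ℤ.+ + k) (pos-+ z a) ⟨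
    + (z + a) ℤ.+ + b ℤ.+ + k    ≡⟨ cong (ℤ._+ + k) (pos-+ (z + a) b) ⟨
    + (z + a + b) ℤ.+ + k        ≡⟨ pos-+ (z + a + b) k ⟨
    + (z + a + b + k)            ≡⟨ cong +_ total ⟩
    + (N + Z)                    ≡⟨ pos-+ N Z ⟩
    + N ℤ.+ + Z                  ∎
  take-apart : ∀ z a b k → z ≡ z ℤ.+ a ℤ.+ b ℤ.+ k ℤ.- a ℤ.- b ℤ.- k
  take-apart = ℤ-Solver.solve-∀
  regroup : ∀ N Z a b k → N ℤ.+ Z ℤ.- a ℤ.- b ℤ.- k ≡ N ℤ.+ (Z ℤ.- k) ℤ.- a ℤ.- b
  regroup = ℤ-Solver.solve-∀

-- z(w) = n² + Σᵢ (hᵢ(p_A(w)) - 1) - ab(w) - bb(w): the counting identity with the heights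
-- substituted.  (The argument does not need the hypothesis n ≥ 1.)
lemma7 : (n : ℕ) → 1 ≤ n → (w : Permutation′ (2 * n)) →
    + z n w ≡ + (n * n) ℤ.+ sumℤ (map (λ h → h ℤ.- + 1) (heights n (pA-downs n w)))
              ℤ.- + ab n w ℤ.- + bb n w
lemma7 n _ w = begin
  + z n w
    ≡⟨ isolate counting ⟩
  + (n * n) ℤ.+ (+ Z ℤ.- + (2 * X + n)) ℤ.- + ab n w ℤ.- + bb n w
    ≡⟨ cong (λ s → + (n * n) ℤ.+ s ℤ.- + ab n w ℤ.- + bb n w) heights-pA ⟨
  + (n * n) ℤ.+ sumℤ (map (λ h → h ℤ.- + 1) (heights n (pA-downs n w))) ℤ.- + ab n w ℤ.- + bb n w ∎
  where
  open ≡-Reasoning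
  open CrossoutCounts n w
  open PairCounting (val w) (val-injective w) (inA n w) using (X; Z)
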